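{- Let $P$ be a definite logic program, $\leftarrow Q$ a query ($Q$ a conjunction of atoms), and $J$ a pre-interpretation of $P$ with finite domain $D$. Then the abstracted query $\leftarrow Q^a$ fails for the program $P^a\cup P^a_J$ under a sound and complete proof procedure (equivalently, the existential closure of $Q^a$ is false in the least Herbrand model of $P^a\cup P^a_J$) if and only if there exists an interpretation $I$ based on $J$ which is a model of $P$ and in which the existential closure of $Q$ is false.
   Context: A pre-interpretation $J$ of $P$ consists of a domain $D$ and for each functor $f/n$ of $P$ a map $f_J:D^n\to D$; an interpretation based on $J$ additionally assigns a truth value to each atom $p(d_1,\dots,d_n)$ with $d_i\in D$. Abstract compilation: in a clause (or query), repeatedly replace a non-variable term $f(t_1,\dots,t_n)$ by a fresh variable $X$ and add the atom $p_f(t_1,\dots,t_n,X)$ to the body, where $p_f/(n+1)$ is a new predicate symbol associated with $f/n$, until no non-variable terms remain. $P^a$ is the set of abstracted clauses of $P$ and $Q^a$ the abstracted query body. $P^a_J$ is the set of facts $\{p_f(d_1,\dots,d_n,d)\leftarrow \;:\; f_J(d_1,\dots,d_n)=d\}$, where elements of $D$ are used as constants. A query fails for a program under a sound and complete proof procedure iff its existential closure is not a logical consequence of the program. -}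

module Defs where

open import Data.Nat using (ℕ; zero; suc)
open import Data.Fin using (Fin; zero)
open import Data.Vec using (Vec; []; _∷_; _∷ʳ_)
open import Data.List using (List; []; _∷_; _++_)
open import Data.List.Relation.Unary.All using (All)
open import Data.Product using (Σ; _×_; _,_; ∃; proj₁)
open import Data.Sum using (_⊎_; inj₁; inj₂; [_,_])
open import Data.Bool using (Bool; T)
open import Function using (_∘_)

record Sig : Set₁ where
  field
    Fun  : Set
    fa   : Fun → ℕ
    Pred : Set
    pa   : Pred → ℕ
open Sig public

record ProgSig : Set where
  field
    nF : ℕ
    fA : Fin nF → ℕ
    nP : ℕ
    pA : Fin nP → ℕ

toSig : ProgSig → Sig
toSig Σ₀ = record { Fun = Fin (ProgSig.nF Σ₀) ; fa = ProgSig.fA Σ₀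
                  ; Pred = Fin (ProgSig.nP Σ₀) ; pa = ProgSig.pA Σ₀ }

data Term (S : Sig) (V : Set) : Set where
  var : V → Term S V
  fn  : (f : Fun S) → Vec (Term S V) (fa S f) → Term S V

record Atom (S : Sig) (V : Set) : Set where
  constructor atom
  field
    pred : Pred S
    args : Vec (Term S V) (pa S pred)

record Clause (S : Sig) (V : Set) : Set where
  constructor _⟵_
  field
    head : Atom S V
    body : List (Atom S V)

record Theory (S : Sig) (V : Set) : Set₁ where
  constructor theory
  field
    Idx    : Set
    clause : Idx → Clause S V

data _∈ᶜ_ {S : Sig} {V : Set} : Clause S V → List (Clause S V) → Set where
  here  : ∀ {c cs} → c ∈ᶜ (c ∷ cs)
  there : ∀ {c d cs} → c ∈ᶜ cs → c ∈ᶜ (d ∷ cs)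

listTheory : ∀ {S V} → List (Clause S V) → Theory S V
listTheory P = theory (Σ _ λ c → c ∈ᶜ P) proj₁

_∪ᵗ_ : ∀ {S V} → Theory S V → Theory S V → Theory S V
theory I c ∪ᵗ theory I' c' = theory (I ⊎ I') [ c , c' ]

record Structure (S : Sig) : Set₁ where
  field
    Dom       : Set
    inhabited : Dom
    fun       : (f : Fun S) → Vec Dom (fa S f) → Dom
    rel       : (p : Pred S) → Vec Dom (pa S p) → Set
open Structure public

module _ {S : Sig} (M : Structure S) {V : Set} (σ : V → Dom M) where
  mutual
    evalT : Term S V → Dom M
    evalT (var x)   = σ x
    evalT (fn f ts) = fun M f (evalTs ts)

    evalTs : ∀ {k} → Vec (Term S V) k → Vec (Dom M) k
    evalTs []       = []
    evalTs (t ∷ ts) = evalT t ∷ evalTs ts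

  holds : Atom S V → Set
  holds (atom p ts) = rel M p (evalTs ts)

SatClause : ∀ {S V} → Structure S → Clause S V → Set
SatClause M (h ⟵ b) = ∀ σ → All (holds M σ) b → holds M σ h

IsModel : ∀ {S V} → Structure S → Theory S V → Set
IsModel M T = ∀ i → SatClause M (Theory.clause T i)

ExClosure : ∀ {S V} → Structure S → List (Atom S V) → Set
ExClosure {V = V} M Q = Σ (V → Dom M) λ σ → All (holds M σ) Q

_⊨∃_ : ∀ {S V} → Theory S V → List (Atom S V) → Set₁
_⊨∃_ {S} T Q = (M : Structure S) → IsModel M T → ExClosure M Q

record PreInterp (S : Sig) (D : Set) : Set where
  field
    funJ : (f : Fun S) → Vec D (fa S f) → D
open PreInterp public

Interp : (S : Sig) (D : Set) → Set
Interp S D = (p : Pred S) → Vec D (pa S p) → Bool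

interpStructure : ∀ {S D} → D → PreInterp S D → Interp S D → Structure S
interpStructure {D = D} d₀ J I = record
  { Dom = D ; inhabited = d₀ ; fun = funJ J ; rel = λ p ds → T (I p ds) }

-- signature of P^a ∪ P^a_J: functors are the elements of D (constants),
-- predicates are those of P plus a new p_f/(n+1) for each functor f/n.
absSig : Sig → Set → Sig
absSig S D = record
  { Fun = D ; fa = λ _ → 0
  ; Pred = Pred S ⊎ Fun S ; pa = [ pa S , suc ∘ fa S ] }

-- variables of abstracted clauses: original variables (inj₁) and
-- fresh variables (inj₂ k)
AVar : Set
AVar = ℕ ⊎ ℕ

module Abstraction (S : Sig) (D : Set) where
  AS = absSig S D

  mutual
    -- flatten a term, given the next fresh-variable index
    flatT : Term S ℕ → ℕ → Term AS AVar × List (Atom AS AVar) × ℕ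
    flatT (var x)   c = var (inj₁ x) , [] , c
    flatT (fn f ts) c = step (flatTs ts c)
      where
      step : Vec (Term AS AVar) (fa S f) × List (Atom AS AVar) × ℕ
           → Term AS AVar × List (Atom AS AVar) × ℕ
      step (xs , as , c') =
        var (inj₂ c') , as ++ (atom (inj₂ f) (xs ∷ʳ var (inj₂ c')) ∷ []) , suc c'

    flatTs : ∀ {k} → Vec (Term S ℕ) k → ℕ
           → Vec (Term AS AVar) k × List (Atom AS AVar) × ℕ
    flatTs []       c = [] , [] , c
    flatTs (t ∷ ts) c with flatT t c
    ... | x , as , c' with flatTs ts c'
    ... | xs , bs , c'' = (x ∷ xs) , as ++ bs , c''

  flatAtom : Atom S ℕ → ℕ → Atom AS AVar × List (Atom AS AVar) × ℕ
  flatAtom (atom p ts) c with flatTs ts c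
  ... | xs , as , c' = atom (inj₁ p) xs , as , c'

  flatBody : List (Atom S ℕ) → ℕ → List (Atom AS AVar) × ℕ
  flatBody []      c = [] , c
  flatBody (a ∷ q) c with flatAtom a c
  ... | a' , as , c' with flatBody q c'
  ... | bs , c'' = as ++ (a' ∷ bs) , c''

  absClause : Clause S ℕ → Clause AS AVar
  absClause (h ⟵ b) with flatAtom h 0
  ... | h' , hs , c with flatBody b c
  ... | bs , _ = h' ⟵ (hs ++ bs)

  absProgram : List (Clause S ℕ) → List (Clause AS AVar)
  absProgram []      = []
  absProgram (c ∷ P) = absClause c ∷ absProgram P

  absQuery : List (Atom S ℕ) → List (Atom AS AVar)
  absQuery Q = proj₁ (flatBody Q 0)

  constT : D → Term AS AVar
  constT d = fn d []

  mapConst : ∀ {k} → Vec D k → Vec (Term AS AVar) k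
  mapConst []       = []
  mapConst (d ∷ ds) = constT d ∷ mapConst ds

  PaJ : PreInterp S D → Theory AS AVar
  PaJ J = theory (Σ (Fun S) λ f → Vec D (fa S f))
    λ { (f , ds) → atom (inj₂ f) (mapConst ds ∷ʳ constT (funJ J f ds)) ⟵ [] }

-- (⇐) A model I of P based on J yields a model of Pᵃ ∪ Pᵃ_J on the same domain D, interpreting
-- each p_f by the graph of f_J; flattening is sound there, so a solution of Qᵃ in it would be a
-- solution of Q in I.
-- (⇒) As D is finite, the least model of P based on J is computable by iterating the
-- immediate-consequence operator. Every model M of Pᵃ ∪ Pᵃ_J receives a homomorphism (d ↦ the
-- constant d) from the structure built from the least model: the graph facts hold in M, and the atoms
-- of the least model hold in M by induction along the iteration, since flattening is complete (the
-- fresh variables can always be given values). A solution of Q in the least model, completed by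
-- such values, is thus carried to a solution of Qᵃ in M.
module Submission where

open import Defs
open import Data.Bool using (Bool; false; true; T; if_then_else_; _∨_)
open import Data.Bool.Properties using (T-∨)
open import Data.Empty using (⊥-elim)
open import Data.Fin using (Fin; zero)
import Data.Fin.Properties as Fin
open import Data.List
  using (List; []; _∷_; _++_; length; allFin; cartesianProductWith; concatMap; map)
open import Data.List.Membership.Propositional using (lose)
open import Data.List.Membership.Propositional.Properties
  using (∈-allFin; ∈-map⁺; ∈-concatMap⁺; ∈-cartesianProductWith⁺)
open import Data.List.Relation.Unary.All using (All; []; _∷_; all?)
import Data.List.Relation.Unary.All as All
open import Data.List.Relation.Unary.All.Properties using (++⁺; ++⁻)
open import Data.List.Relation.Unary.Any using (Any; here; there; any?; satisfied)
open import Data.List.Relation.Unary.Enumerates.Setoid using (IsEnumeration)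
open import Data.Nat using (ℕ; zero; suc; _+_; _≤_; _<_; _⊔_; z≤n; s≤s)
open import Data.Nat.Properties
  using (≤-trans; <-≤-trans; <⇒≢; <⇒≱; m≤n⇒m≤1+n; m<n⇒m<1+n; n<1+n; n≤1+n; m≤m+n; +-suc;
         +-monoʳ-≤; m⊔n≤o⇒m≤o; m⊔n≤o⇒n≤o; m≤m⊔n; m≤n⊔m)
import Data.Nat.Properties as ℕ
open import Data.Product using (Σ; Σ-syntax; ∃; _×_; _,_; proj₁; proj₂; curry)
open import Data.Product.Properties using () renaming (≡-dec to Σ-≡-dec)
open import Data.Sum using (inj₁; inj₂; [_,_]′)
open import Data.Vec using (Vec; []; _∷_; _∷ʳ_)
import Data.Vec as Vec
open import Data.Vec.Properties
  using (∷ʳ-injective; map-id; map-∷ʳ) renaming (≡-dec to Vec-≡-dec)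
open import Function using (_∘_; _⇔_; mk⇔; Equivalence)
open import Relation.Binary using (DecidableEquality)
open import Relation.Binary.PropositionalEquality
  using (_≡_; refl; sym; trans; cong; cong₂; subst; setoid)
open import Relation.Nullary using (¬_; Dec; yes; no; ¬?; _×-dec_)
open import Relation.Nullary.Decidable using (map′; isYes; toWitness; fromWitness; T?)

private
  variable
    A : Set
    S : Sig
    c c₁ out : ℕ
    τ : ℕ → A
    G G′ : (ℕ → A) → Set

evalTs-∷ʳ : (M : Structure S) {V : Set} (σ : V → Dom M) {k : ℕ}
            (ts : Vec (Term S V) k) (t : Term S V) →
            evalTs M σ (ts ∷ʳ t) ≡ evalTs M σ ts ∷ʳ evalT M σ t
evalTs-∷ʳ M σ []       t = refl
evalTs-∷ʳ M σ (u ∷ ts) t = cong (evalT M σ u ∷_) (evalTs-∷ʳ M σ ts t)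

record Homomorphism (M N : Structure S) : Set where
  field
    ⟦_⟧     : Dom M → Dom N
    fun-hom : ∀ f ds → ⟦ fun M f ds ⟧ ≡ fun N f (Vec.map ⟦_⟧ ds)
    rel-hom : ∀ p ds → rel M p ds → rel N p (Vec.map ⟦_⟧ ds)

module _ {M N : Structure S} (H : Homomorphism M N) {V : Set} (σ : V → Dom M) where
  open Homomorphism H

  mutual
    evalT-hom : (t : Term S V) → evalT N (⟦_⟧ ∘ σ) t ≡ ⟦ evalT M σ t ⟧
    evalT-hom (var x)   = refl
    evalT-hom (fn f ts) = trans (cong (fun N f) (evalTs-hom ts)) (sym (fun-hom f (evalTs M σ ts)))

    evalTs-hom : ∀ {k} (ts : Vec (Term S V) k) →
                 evalTs N (⟦_⟧ ∘ σ) ts ≡ Vec.map ⟦_⟧ (evalTs M σ ts)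
    evalTs-hom []       = refl
    evalTs-hom (t ∷ ts) = cong₂ _∷_ (evalT-hom t) (evalTs-hom ts)

  holds-hom : ∀ {a} → holds M σ a → holds N (⟦_⟧ ∘ σ) a
  holds-hom {atom p ts} h = subst (rel N p) (sym (evalTs-hom ts)) (rel-hom p _ h)

  All-holds-hom : ∀ {as} → All (holds M σ) as → All (holds N (⟦_⟧ ∘ σ)) as
  All-holds-hom = All.map holds-hom

_≈[_]_ : (ℕ → A) → ℕ → (ℕ → A) → Set
τ ≈[ c ] τ′ = ∀ {k} → k < c → τ k ≡ τ′ k

mutual
  varBound : Term S ℕ → ℕ
  varBound (var x)   = suc x
  varBound (fn f ts) = varBoundᵛ ts

  varBoundᵛ : ∀ {k} → Vec (Term S ℕ) k → ℕ
  varBoundᵛ []       = 0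
  varBoundᵛ (t ∷ ts) = varBound t ⊔ varBoundᵛ ts

varBoundˡ : List (Atom S ℕ) → ℕ
varBoundˡ []               = 0
varBoundˡ (atom p ts ∷ as) = varBoundᵛ ts ⊔ varBoundˡ as

varBoundᶜ : Clause S ℕ → ℕ
varBoundᶜ (atom p ts ⟵ b) = varBoundᵛ ts ⊔ varBoundˡ b

module _ (M : Structure S) {m : ℕ} {σ σ′ : ℕ → Dom M} (σ≈σ′ : σ ≈[ m ] σ′) where
  mutual
    evalT-cong : ∀ t → varBound t ≤ m → evalT M σ t ≡ evalT M σ′ t
    evalT-cong (var x)   x<m = σ≈σ′ x<m
    evalT-cong (fn f ts) b≤m = cong (fun M f) (evalTs-cong ts b≤m)

    evalTs-cong : ∀ {k} (ts : Vec (Term S ℕ) k) → varBoundᵛ ts ≤ m →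
                  evalTs M σ ts ≡ evalTs M σ′ ts
    evalTs-cong []       _   = refl
    evalTs-cong (t ∷ ts) b≤m =
      cong₂ _∷_ (evalT-cong t (m⊔n≤o⇒m≤o _ _ b≤m)) (evalTs-cong ts (m⊔n≤o⇒n≤o _ _ b≤m))

  All-holds-cong : ∀ as → varBoundˡ as ≤ m → All (holds M σ) as → All (holds M σ′) as
  All-holds-cong []               _   []       = []
  All-holds-cong (atom p ts ∷ as) b≤m (h ∷ hs) =
    subst (rel M p) (evalTs-cong ts (m⊔n≤o⇒m≤o _ _ b≤m)) h
    ∷ All-holds-cong as (m⊔n≤o⇒n≤o _ _ b≤m) hs

prefix : (ℕ → A) → ∀ m → Vec A m
prefix σ zero    = []
prefix σ (suc m) = σ 0 ∷ prefix (σ ∘ suc) m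

fromPrefix : A → ∀ {m} → Vec A m → ℕ → A
fromPrefix d []      _       = d
fromPrefix d (a ∷ v) zero    = a
fromPrefix d (a ∷ v) (suc x) = fromPrefix d v x

≈-fromPrefix-prefix : (d : A) (σ : ℕ → A) (m : ℕ) → σ ≈[ m ] fromPrefix d (prefix σ m)
≈-fromPrefix-prefix d σ (suc m) {zero}  _         = refl
≈-fromPrefix-prefix d σ (suc m) {suc x} (s≤s x<m) = ≈-fromPrefix-prefix d (σ ∘ suc) m x<m

_[_≔_] : (ℕ → A) → ℕ → A → ℕ → A
(τ [ c ≔ a ]) k with k ℕ.≟ c
... | yes _ = a
... | no  _ = τ k

[≔]-updated : (τ : ℕ → A) (c : ℕ) (a : A) → (τ [ c ≔ a ]) c ≡ a
[≔]-updated τ c a with c ℕ.≟ c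
... | yes _   = refl
... | no  c≢c = ⊥-elim (c≢c refl)

[≔]-below : (τ : ℕ → A) {c : ℕ} (a : A) {k : ℕ} → k < c → (τ [ c ≔ a ]) k ≡ τ k
[≔]-below τ {c} a {k} k<c with k ℕ.≟ c
... | yes k≡c = ⊥-elim (<⇒≢ k<c k≡c)
... | no  _   = refl

-- Fresh variables c, c+1, …, out−1 can be given values, leaving the variables below c as in τ,
-- so that G holds whatever the variables from out on are.
record Solvable (c out : ℕ) (τ : ℕ → A) (G : (ℕ → A) → Set) : Set where
  constructor solvable
  field
    fresh-≤  : c ≤ out
    solution : ℕ → A
    keeps    : solution ≈[ c ] τ
    solves   : ∀ {τ′} → τ′ ≈[ out ] solution → G τ′

solvable-trivial : (∀ τ′ → G τ′) → Solvable c c τ G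
solvable-trivial g = solvable ℕ.≤-refl _ (λ _ → refl) (λ {τ′} _ → g τ′)

solvable-map : (∀ {τ′} → G τ′ → G′ τ′) → Solvable c out τ G → Solvable c out τ G′
solvable-map g (solvable c≤out τ₁ keeps solves) = solvable c≤out τ₁ keeps (g ∘ solves)

solvable-seq : ∀ {c₂} → Solvable c c₁ τ G → (∀ τ₁ → Solvable c₁ c₂ τ₁ G′) →
               Solvable c c₂ τ (λ τ′ → G τ′ × G′ τ′)
solvable-seq (solvable c≤c₁ τ₁ keeps₁ solves₁) next with next τ₁
... | solvable c₁≤c₂ τ₂ keeps₂ solves₂ =
  solvable (≤-trans c≤c₁ c₁≤c₂) τ₂
    (λ k<c → trans (keeps₂ (<-≤-trans k<c c≤c₁)) (keeps₁ k<c))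
    (λ τ′≈τ₂ → solves₁ (λ k<c₁ → trans (τ′≈τ₂ (<-≤-trans k<c₁ c₁≤c₂)) (keeps₂ k<c₁))
             , solves₂ τ′≈τ₂)

solvable-assign : (a : A) → Solvable c c₁ τ G →
                  Solvable c (suc c₁) τ (λ τ′ → G τ′ × τ′ c₁ ≡ a)
solvable-assign {c₁ = c₁} a (solvable c≤c₁ τ₁ keeps solves) =
  solvable (≤-trans c≤c₁ (n≤1+n c₁)) (τ₁ [ c₁ ≔ a ])
    (λ k<c → trans ([≔]-below τ₁ a (<-≤-trans k<c c≤c₁)) (keeps k<c))
    (λ τ′≈ → solves (λ k<c₁ → trans (τ′≈ (m<n⇒m<1+n k<c₁)) ([≔]-below τ₁ a k<c₁))
           , trans (τ′≈ (n<1+n c₁)) ([≔]-updated τ₁ c₁ a))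

solvable-witness : Solvable c out τ G → ∃ G
solvable-witness (solvable _ τ₁ _ solves) = τ₁ , solves (λ _ → refl)

-- Finite enumerations and least fixpoints

∃-enumeration? : ∀ {xs} {R : A → Set} → IsEnumeration (setoid A) xs →
                 (∀ x → Dec (R x)) → Dec (∃ R)
∃-enumeration? {xs = xs} enum R? = map′ satisfied (λ (x , r) → lose (enum x) r) (any? R? xs)

vecs : List A → ∀ k → List (Vec A k)
vecs xs zero    = [] ∷ []
vecs xs (suc k) = cartesianProductWith _∷_ xs (vecs xs k)

vecs-enumerates : ∀ {xs} → IsEnumeration (setoid A) xs →
                  ∀ k → IsEnumeration (setoid (Vec A k)) (vecs xs k)
vecs-enumerates enum zero    []      = here refl
vecs-enumerates enum (suc k) (a ∷ v) =
  ∈-cartesianProductWith⁺ _∷_ (enum a) (vecs-enumerates enum k v)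

count : (A → Bool) → List A → ℕ
count I []       = 0
count I (x ∷ xs) = if I x then suc (count I xs) else count I xs

count≤length : (I : A → Bool) (xs : List A) → count I xs ≤ length xs
count≤length I []       = z≤n
count≤length I (x ∷ xs) with I x
... | true  = s≤s (count≤length I xs)
... | false = m≤n⇒m≤1+n (count≤length I xs)

module _ {I I′ : A → Bool} (I⊆I′ : ∀ {x} → T (I x) → T (I′ x)) where

  count-mono-≤ : ∀ xs → count I xs ≤ count I′ xs
  count-mono-≤ []       = z≤n
  count-mono-≤ (x ∷ xs) with I x | I′ x | I⊆I′ {x}
  ... | true  | true  | _ = s≤s (count-mono-≤ xs)
  ... | true  | false | f = ⊥-elim (f _)
  ... | false | true  | _ = m≤n⇒m≤1+n (count-mono-≤ xs)
  ... | false | false | _ = count-mono-≤ xs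

  count-mono-< : ∀ {xs} → Any (λ x → T (I′ x) × ¬ T (I x)) xs → count I xs < count I′ xs
  count-mono-< {x ∷ xs} (here (I′x , ¬Ix)) with I x | I′ x
  ... | true  | _     = ⊥-elim (¬Ix _)
  ... | false | false = ⊥-elim I′x
  ... | false | true  = s≤s (count-mono-≤ xs)
  count-mono-< {x ∷ xs} (there new) with I x | I′ x | I⊆I′ {x}
  ... | true  | true  | _ = s≤s (count-mono-< new)
  ... | true  | false | f = ⊥-elim (f _)
  ... | false | true  | _ = m<n⇒m<1+n (count-mono-< new)
  ... | false | false | _ = count-mono-< new

-- Iteration stops at the first round that adds nothing; every other round raises count, which is
-- bounded by length as, so suc (length as) rounds reach a fixpoint.
module FiniteLeastFixpoint {as : List A} (enum : IsEnumeration (setoid A) as)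
                           (F : (A → Bool) → A → Bool) where

  step : (A → Bool) → A → Bool
  step I x = I x ∨ F I x

  Grows : (A → Bool) → Set
  Grows I = Any (λ x → T (step I x) × ¬ T (I x)) as

  grows? : ∀ I → Dec (Grows I)
  grows? I = any? (λ x → T? (step I x) ×-dec ¬? (T? (I x))) as

  iterate : ℕ → (A → Bool) → A → Bool
  iterate zero    I = I
  iterate (suc k) I with grows? I
  ... | yes _ = iterate k (step I)
  ... | no  _ = I

  iterate-stable : ∀ k I → length as < k + count I as → ¬ Grows (iterate k I)
  iterate-stable zero    I overfull _ = <⇒≱ overfull (count≤length I as)
  iterate-stable (suc k) I overfull with grows? I
  ... | no  ¬grows = ¬grows
  ... | yes grows  = iterate-stable k (step I)
    (<-≤-trans overfull (subst (_≤ k + count (step I) as) (+-suc k _)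
      (+-monoʳ-≤ k (count-mono-< (λ Ix → Equivalence.from T-∨ (inj₁ Ix)) grows))))

  iterate-induction : (G : (A → Bool) → Set) → (∀ I → G I → G (step I)) →
                      ∀ k I → G I → G (iterate k I)
  iterate-induction G G-step zero    I g = g
  iterate-induction G G-step (suc k) I g with grows? I
  ... | yes _ = iterate-induction G G-step k (step I) (G-step I g)
  ... | no  _ = g

  lfp : A → Bool
  lfp = iterate (suc (length as)) (λ _ → false)

  lfp-closed : ∀ x → T (F lfp x) → T (lfp x)
  lfp-closed x Fx with T? (lfp x)
  ... | yes lfp-x = lfp-x
  ... | no ¬lfp-x = ⊥-elim (iterate-stable (suc (length as)) (λ _ → false)
                              (≤-trans (n<1+n _) (m≤m+n _ _))
                              (lose (enum x) (Equivalence.from T-∨ (inj₂ Fx) , ¬lfp-x)))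

  lfp-induction : (G : (A → Bool) → Set) → G (λ _ → false) → (∀ I → G I → G (step I)) → G lfp
  lfp-induction G G-false G-step = iterate-induction G G-step (suc (length as)) (λ _ → false) G-false

-- Semantics of abstract compilation

module AbstractSemantics {D : Set} (d₀ : D) (J : PreInterp S D) where
  open Abstraction S D

  evalTs-mapConst : (M : Structure AS) (σ : AVar → Dom M) {k : ℕ} (ds : Vec D k) →
                    evalTs M σ (mapConst ds) ≡ Vec.map (λ d → fun M d []) ds
  evalTs-mapConst M σ []       = refl
  evalTs-mapConst M σ (d ∷ ds) = cong (fun M d [] ∷_) (evalTs-mapConst M σ ds)

  ∈ᶜ-absProgram⁺ : ∀ {cl P} → cl ∈ᶜ P → absClause cl ∈ᶜ absProgram P
  ∈ᶜ-absProgram⁺ here      = here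
  ∈ᶜ-absProgram⁺ (there m) = there (∈ᶜ-absProgram⁺ m)

  ∈ᶜ-absProgram⁻ : ∀ P {cl′} → cl′ ∈ᶜ absProgram P →
                   Σ[ cl ∈ Clause S ℕ ] cl ∈ᶜ P × cl′ ≡ absClause cl
  ∈ᶜ-absProgram⁻ (cl ∷ P) here      = cl , here , refl
  ∈ᶜ-absProgram⁻ (cl ∷ P) (there m) with ∈ᶜ-absProgram⁻ P m
  ... | cl′ , m′ , eq = cl′ , there m′ , eq

  -- Elements of D are read in M through the constants naming them.
  _⊆ᴵ_ : Interp S D → Structure AS → Set
  I ⊆ᴵ M = ∀ p ds → T (I p ds) → rel M (inj₁ p) (Vec.map (λ d → fun M d []) ds)

  module _ (I : Interp S D) where

    JI : Structure S
    JI = interpStructure d₀ J I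

    abstractRel : (p : Pred AS) → Vec D (pa AS p) → Set
    abstractRel (inj₁ p) ds = T (I p ds)
    abstractRel (inj₂ f) ds = ∃ λ es → ds ≡ es ∷ʳ funJ J f es

    abstractStructure : Structure AS
    abstractStructure = record { Dom = D ; inhabited = d₀ ; fun = λ d _ → d ; rel = abstractRel }

    private
      Jᵃ = abstractStructure

    mutual
      flatT-sound : ∀ t c {σ} → All (holds Jᵃ σ) (proj₁ (proj₂ (flatT t c))) →
                    evalT Jᵃ σ (proj₁ (flatT t c)) ≡ evalT JI (σ ∘ inj₁) t
      flatT-sound (var x)   c     _  = refl
      flatT-sound (fn f ts) c {σ} hs with flatTs ts c | flatTs-sound ts c {σ}
      ... | xs , as , c′ | ih with ++⁻ as hs
      ... | has , ((es , eq) ∷ [])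
        with ∷ʳ-injective _ _ (trans (sym (evalTs-∷ʳ Jᵃ σ xs (var (inj₂ c′)))) eq)
      ... | xs≡es , c′≡ = trans c′≡ (cong (funJ J f) (trans (sym xs≡es) (ih has)))

      flatTs-sound : ∀ {k} (ts : Vec (Term S ℕ) k) c {σ} →
                     All (holds Jᵃ σ) (proj₁ (proj₂ (flatTs ts c))) →
                     evalTs Jᵃ σ (proj₁ (flatTs ts c)) ≡ evalTs JI (σ ∘ inj₁) ts
      flatTs-sound []       c     _  = refl
      flatTs-sound (t ∷ ts) c {σ} hs with flatT t c | flatT-sound t c {σ}
      ... | x , as , c′ | ih₁ with flatTs ts c′ | flatTs-sound ts c′ {σ}
      ... | xs , bs , c″ | ih₂ with ++⁻ as hs
      ... | has , hbs = cong₂ _∷_ (ih₁ has) (ih₂ hbs)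

    graph-holds : ∀ {σ x} f {xs : Vec (Term AS AVar) (fa S f)} {es} →
                  evalTs Jᵃ σ xs ≡ es → σ x ≡ funJ J f es → holds Jᵃ σ (atom (inj₂ f) (xs ∷ʳ var x))
    graph-holds {σ} {x} f {xs} {es} xs≡ x≡ = es , trans (evalTs-∷ʳ Jᵃ σ xs (var x)) (cong₂ _∷ʳ_ xs≡ x≡)

    mutual
      flatT-complete : (σ : ℕ → D) (t : Term S ℕ) (c : ℕ) (τ : ℕ → D) →
        Solvable c (proj₂ (proj₂ (flatT t c))) τ λ τ′ →
          All (holds Jᵃ [ σ , τ′ ]′) (proj₁ (proj₂ (flatT t c))) ×
          evalT Jᵃ [ σ , τ′ ]′ (proj₁ (flatT t c)) ≡ evalT JI σ t
      flatT-complete σ (var x)   c τ = solvable-trivial (λ _ → [] , refl)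
      flatT-complete σ (fn f ts) c τ with flatTs ts c | flatTs-complete σ ts c τ
      ... | xs , as , c′ | args =
        solvable-map (λ ((has , xs≡) , c′≡) → ++⁺ has (graph-holds f xs≡ c′≡ ∷ []) , c′≡)
                     (solvable-assign (funJ J f (evalTs JI σ ts)) args)

      flatTs-complete : (σ : ℕ → D) {k : ℕ} (ts : Vec (Term S ℕ) k) (c : ℕ) (τ : ℕ → D) →
        Solvable c (proj₂ (proj₂ (flatTs ts c))) τ λ τ′ →
          All (holds Jᵃ [ σ , τ′ ]′) (proj₁ (proj₂ (flatTs ts c))) ×
          evalTs Jᵃ [ σ , τ′ ]′ (proj₁ (flatTs ts c)) ≡ evalTs JI σ ts
      flatTs-complete σ []       c τ = solvable-trivial (λ _ → [] , refl)
      flatTs-complete σ (t ∷ ts) c τ with flatT t c | flatT-complete σ t c τ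
      ... | x , as , c′ | first with flatTs ts c′ | flatTs-complete σ ts c′
      ... | xs , bs , c″ | rest =
        solvable-map (λ ((has , x≡) , (hbs , xs≡)) → ++⁺ has hbs , cong₂ _∷_ x≡ xs≡)
                     (solvable-seq first rest)

    flatBody-sound : ∀ q c {σ} → All (holds Jᵃ σ) (proj₁ (flatBody q c)) →
                     All (holds JI (σ ∘ inj₁)) q
    flatBody-sound []               c     _  = []
    flatBody-sound (atom p ts ∷ q) c {σ} hs with flatTs ts c | flatTs-sound ts c {σ}
    ... | xs , as , c′ | args with flatBody q c′ | flatBody-sound q c′ {σ}
    ... | bs , _ | rest with ++⁻ as hs
    ... | has , (ha ∷ hbs) = subst (T ∘ I p) (args has) ha ∷ rest hbs

    flatBody-complete : (σ : ℕ → D) (q : List (Atom S ℕ)) (c : ℕ) (τ : ℕ → D) →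
      All (holds JI σ) q →
      Solvable c (proj₂ (flatBody q c)) τ λ τ′ → All (holds Jᵃ [ σ , τ′ ]′) (proj₁ (flatBody q c))
    flatBody-complete σ []               c τ []        = solvable-trivial (λ _ → [])
    flatBody-complete σ (atom p ts ∷ q) c τ (ha ∷ hq) with flatTs ts c | flatTs-complete σ ts c τ
    ... | xs , as , c′ | args with flatBody q c′ | (λ τ₁ → flatBody-complete σ q c′ τ₁ hq)
    ... | bs , _ | rest =
      solvable-map (λ ((has , xs≡) , hbs) → ++⁺ has (subst (T ∘ I p) (sym xs≡) ha ∷ hbs))
                   (solvable-seq args rest)

    absClause-sound : ∀ cl → SatClause JI cl → SatClause Jᵃ (absClause cl)
    absClause-sound (atom p ts ⟵ b) sat with flatTs ts 0 | flatTs-sound ts 0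
    ... | xs , hs , c | args with flatBody b c | flatBody-sound b c
    ... | bs , _ | body = λ σ hhbs →
      let has , hbs = ++⁻ hs hhbs in subst (T ∘ I p) (sym (args has)) (sat (σ ∘ inj₁) (body hbs))

    abstractStructure-isModel : ∀ P → IsModel JI (listTheory P) →
                                IsModel Jᵃ (listTheory (absProgram P) ∪ᵗ PaJ J)
    abstractStructure-isModel P JI⊨P (inj₁ (_ , m)) with ∈ᶜ-absProgram⁻ P m
    ... | cl , m′ , refl = absClause-sound cl (JI⊨P (cl , m′))
    abstractStructure-isModel P JI⊨P (inj₂ (f , ds)) σ _ =
      ds , trans (evalTs-∷ʳ Jᵃ σ (mapConst ds) _)
                 (cong (_∷ʳ funJ J f ds) (trans (evalTs-mapConst Jᵃ σ ds) (map-id ds)))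

    absQuery-sound : ∀ P Q → IsModel JI (listTheory P) →
                     (listTheory (absProgram P) ∪ᵗ PaJ J) ⊨∃ absQuery Q → ExClosure JI Q
    absQuery-sound P Q JI⊨P ⊨Qᵃ with ⊨Qᵃ Jᵃ (abstractStructure-isModel P JI⊨P)
    ... | σ , hQᵃ = σ ∘ inj₁ , flatBody-sound Q 0 hQᵃ

    abstractStructure-hom : (M : Structure AS) → IsModel M (PaJ J) → I ⊆ᴵ M → Homomorphism Jᵃ M
    abstractStructure-hom M M⊨PaJ I⊆M = record
      { ⟦_⟧     = ⟦_⟧
      ; fun-hom = λ { _ [] → refl }
      ; rel-hom = λ { (inj₁ p) → I⊆M p ; (inj₂ f) _ (es , refl) → graph f es } }
      where
      ⟦_⟧ : D → Dom M
      ⟦ d ⟧ = fun M d []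

      graph : ∀ f es → rel M (inj₂ f) (Vec.map ⟦_⟧ (es ∷ʳ funJ J f es))
      graph f es = subst (rel M (inj₂ f))
        (trans (evalTs-∷ʳ M σ₀ (mapConst es) _)
               (trans (cong (_∷ʳ ⟦ funJ J f es ⟧) (evalTs-mapConst M σ₀ es))
                      (sym (map-∷ʳ ⟦_⟧ _ es))))
        (M⊨PaJ (f , es) σ₀ [])
        where
        σ₀ : AVar → Dom M
        σ₀ _ = inhabited M

    module _ {M : Structure AS} (H : Homomorphism Jᵃ M) where
      open Homomorphism H

      absClause-reflects : ∀ p ts b → SatClause M (absClause (atom p ts ⟵ b)) →
                           ∀ σ → All (holds JI σ) b →
                           rel M (inj₁ p) (Vec.map ⟦_⟧ (evalTs JI σ ts))
      absClause-reflects p ts b sat σ hb with flatTs ts 0 | flatTs-complete σ ts 0 (λ _ → d₀)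
      ... | xs , hs , c | head with flatBody b c | (λ τ → flatBody-complete σ b c τ hb)
      ... | bs , _ | body with solvable-witness (solvable-seq head body)
      ... | τ , (hhs , xs≡) , hbs =
        subst (rel M (inj₁ p)) (trans (evalTs-hom H [ σ , τ ]′ xs) (cong (Vec.map ⟦_⟧) xs≡))
          (sat (⟦_⟧ ∘ [ σ , τ ]′) (All-holds-hom H [ σ , τ ]′ (++⁺ hhs hbs)))

      absQuery-complete : ∀ Q → ExClosure JI Q → ExClosure M (absQuery Q)
      absQuery-complete Q (σ , hQ) with solvable-witness (flatBody-complete σ Q 0 (λ _ → d₀) hQ)
      ... | τ , hQᵃ = ⟦_⟧ ∘ [ σ , τ ]′ , All-holds-hom H [ σ , τ ]′ hQᵃ

-- The least model over a finite domain

∃-∈ᶜ? : {R : Clause S ℕ → Set} → (∀ cl → Dec (R cl)) →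
        ∀ P → Dec (Σ[ cl ∈ Clause S ℕ ] cl ∈ᶜ P × R cl)
∃-∈ᶜ? R? []       = no λ ()
∃-∈ᶜ? R? (cl ∷ P) with R? cl | ∃-∈ᶜ? R? P
... | yes r | _                 = yes (cl , here , r)
... | no _  | yes (cl′ , m , r) = yes (cl′ , there m , r)
... | no ¬r | no ¬rest          =
  no λ { (_ , here , r) → ¬r r ; (cl′ , there m , r) → ¬rest (cl′ , m , r) }

module LeastModel {D : Set} (d₀ : D) (_≟_ : DecidableEquality D) {ds : List D}
                  (D-enum : IsEnumeration (setoid D) ds)
                  (Σ₀ : ProgSig) (J : PreInterp (toSig Σ₀) D)
                  (P : List (Clause (toSig Σ₀) ℕ)) where
  private
    S₀ = toSig Σ₀
  open Abstraction S₀ D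
  open AbstractSemantics d₀ J

  GroundAtom : Set
  GroundAtom = Σ (Pred S₀) λ p → Vec D (pa S₀ p)

  groundAtoms : List GroundAtom
  groundAtoms = concatMap (λ p → map (p ,_) (vecs ds (pa S₀ p))) (allFin _)

  groundAtoms-enumerates : IsEnumeration (setoid GroundAtom) groundAtoms
  groundAtoms-enumerates (p , v) =
    ∈-concatMap⁺ _ (lose (∈-allFin p) (∈-map⁺ (p ,_) (vecs-enumerates D-enum _ v)))

  Fires : Interp S₀ D → Clause S₀ ℕ → (ℕ → D) → GroundAtom → Set
  Fires I (atom p ts ⟵ b) σ a = All (holds (JI I) σ) b × (p , evalTs (JI I) σ ts) ≡ a

  fires? : ∀ I cl σ a → Dec (Fires I cl σ a)
  fires? I (atom p ts ⟵ b) σ a =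
    all? (λ b₁ → T? (I (Atom.pred b₁) (evalTs (JI I) σ (Atom.args b₁)))) b
    ×-dec Σ-≡-dec Fin._≟_ (Vec-≡-dec _≟_) (p , evalTs (JI I) σ ts) a

  Fires-cong : ∀ I cl {σ σ′ a} → σ ≈[ varBoundᶜ cl ] σ′ → Fires I cl σ a → Fires I cl σ′ a
  Fires-cong I (atom p ts ⟵ b) σ≈σ′ (hb , refl) =
    All-holds-cong (JI I) σ≈σ′ b (m≤n⊔m _ _) hb ,
    cong (p ,_) (sym (evalTs-cong (JI I) σ≈σ′ ts (m≤m⊔n _ _)))

  Immediate : Interp S₀ D → GroundAtom → Set
  Immediate I a = Σ[ cl ∈ Clause S₀ ℕ ] cl ∈ᶜ P × ∃ λ σ → Fires I cl σ a

  ImmediateWithin : Interp S₀ D → GroundAtom → Set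
  ImmediateWithin I a =
    Σ[ cl ∈ Clause S₀ ℕ ] cl ∈ᶜ P × Σ[ v ∈ Vec D (varBoundᶜ cl) ] Fires I cl (fromPrefix d₀ v) a

  -- Only the variables below varBoundᶜ cl matter, so it suffices to search the finitely many
  -- assignments of D-values to them.
  immediate? : ∀ I a → Dec (Immediate I a)
  immediate? I a = map′ widen narrow
    (∃-∈ᶜ? (λ cl → ∃-enumeration? (vecs-enumerates D-enum (varBoundᶜ cl))
                                  (λ v → fires? I cl (fromPrefix d₀ v) a)) P)
    where
    widen : ImmediateWithin I a → Immediate I a
    widen (cl , m , v , fires) = cl , m , fromPrefix d₀ v , fires
    narrow : Immediate I a → ImmediateWithin I a
    narrow (cl , m , σ , fires) =
      cl , m , prefix σ _ , Fires-cong I cl (≈-fromPrefix-prefix d₀ σ (varBoundᶜ cl)) fires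

  open FiniteLeastFixpoint groundAtoms-enumerates (λ I a → isYes (immediate? (curry I) a))

  leastModel : Interp S₀ D
  leastModel = curry lfp

  leastModel-isModel : IsModel (JI leastModel) (listTheory P)
  leastModel-isModel (atom p ts ⟵ b , m) σ hb = lfp-closed _ (fromWitness (_ , m , σ , hb , refl))

  leastModel-⊆ᴵ : (M : Structure AS) → IsModel M (listTheory (absProgram P) ∪ᵗ PaJ J) →
                  leastModel ⊆ᴵ M
  leastModel-⊆ᴵ M M⊨ = lfp-induction (λ I → curry I ⊆ᴵ M) (λ _ _ ()) step-⊆ᴵ
    where
    step-⊆ᴵ : ∀ I → curry I ⊆ᴵ M → curry (step I) ⊆ᴵ M
    step-⊆ᴵ I I⊆M p ds t with Equivalence.to T-∨ t
    ... | inj₁ old = I⊆M p ds old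
    ... | inj₂ new with toWitness new
    ... | atom q ts ⟵ b , m , σ , hb , refl =
      absClause-reflects (curry I) (abstractStructure-hom (curry I) M (M⊨ ∘ inj₂) I⊆M)
        q ts b (M⊨ (inj₁ (_ , ∈ᶜ-absProgram⁺ m))) σ hb

  leastModel-hom : (M : Structure AS) → IsModel M (listTheory (absProgram P) ∪ᵗ PaJ J) →
                   Homomorphism (abstractStructure leastModel) M
  leastModel-hom M M⊨ = abstractStructure-hom leastModel M (M⊨ ∘ inj₂) (leastModel-⊆ᴵ M M⊨)

corollary1 : (Σ₀ : ProgSig) (P : List (Clause (toSig Σ₀) ℕ))
    (Q : List (Atom (toSig Σ₀) ℕ)) (n : ℕ)
    (J : PreInterp (toSig Σ₀) (Fin (suc n))) →
    (¬ ((listTheory (Abstraction.absProgram (toSig Σ₀) (Fin (suc n)) P)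
           ∪ᵗ Abstraction.PaJ (toSig Σ₀) (Fin (suc n)) J)
         ⊨∃ Abstraction.absQuery (toSig Σ₀) (Fin (suc n)) Q))
    ⇔ (Σ[ I ∈ Interp (toSig Σ₀) (Fin (suc n)) ]
         (IsModel (interpStructure zero J I) (listTheory P)
          × ¬ ExClosure (interpStructure zero J I) Q))
corollary1 Σ₀ P Q n J = mk⇔
  (λ ¬⊨Qᵃ → leastModel , leastModel-isModel ,
            λ ∃Q → ¬⊨Qᵃ λ M M⊨ → absQuery-complete leastModel (leastModel-hom M M⊨) Q ∃Q)
  (λ (I , JI⊨P , ¬∃Q) ⊨Qᵃ → ¬∃Q (absQuery-sound I P Q JI⊨P ⊨Qᵃ))
  where
  open LeastModel zero Fin._≟_ ∈-allFin Σ₀ J P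
  open AbstractSemantics zero J
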